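{- Let $a,b,c>1$ be integers with $\gcd(a,b)>1$. If the equation $a^x+b^y=c^z$ has a solution in positive integers which is Type A for some prime $p\in Q$, and this solution is not Type A for some prime $q\in Q$, then the equation has no solution which is Type B, Type C, or Type O for $p$.
   Context: $Q$ is the set of primes dividing all of $a$, $b$, $c$. For $r\in Q$ let $r^{\alpha_r}\parallel a$, $r^{\beta_r}\parallel b$, $r^{\gamma_r}\parallel c$. A solution $(x,y,z)$ is Type A for $r$ if $\alpha_rx>\beta_ry=\gamma_rz$; Type B if $\beta_ry>\alpha_rx=\gamma_rz$; Type C if $\gamma_rz>\alpha_rx=\beta_ry$; Type O if $\alpha_rx=\beta_ry=\gamma_rz$. -}

module Defs where

open import Data.Nat using (ℕ; suc; _+_; _*_; _^_; _<_; _>_)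
open import Data.Nat.Divisibility using (_∣_)
open import Data.Nat.Primality using (Prime)
open import Data.Product using (_×_; ∃-syntax)
open import Relation.Nullary using (¬_)
open import Relation.Binary.PropositionalEquality using (_≡_)

_^_∥_ : ℕ → ℕ → ℕ → Set
r ^ k ∥ n = (r ^ k ∣ n) × ¬ (r ^ suc k ∣ n)

InQ : ℕ → ℕ → ℕ → ℕ → Set
InQ a b c r = Prime r × (r ∣ a) × (r ∣ b) × (r ∣ c)

IsSolution : ℕ → ℕ → ℕ → ℕ → ℕ → ℕ → Set
IsSolution a b c x y z = (x > 0) × (y > 0) × (z > 0) × (a ^ x + b ^ y ≡ c ^ z)

TypeA TypeB TypeC TypeO : ℕ → ℕ → ℕ → ℕ → ℕ → ℕ → ℕ → Set
TypeA a b c r x y z = ∃[ α ] ∃[ β ] ∃[ γ ] (r ^ α ∥ a) × (r ^ β ∥ b) × (r ^ γ ∥ c)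
  × (α * x > β * y) × (β * y ≡ γ * z)
TypeB a b c r x y z = ∃[ α ] ∃[ β ] ∃[ γ ] (r ^ α ∥ a) × (r ^ β ∥ b) × (r ^ γ ∥ c)
  × (β * y > α * x) × (α * x ≡ γ * z)
TypeC a b c r x y z = ∃[ α ] ∃[ β ] ∃[ γ ] (r ^ α ∥ a) × (r ^ β ∥ b) × (r ^ γ ∥ c)
  × (γ * z > α * x) × (α * x ≡ β * y)
TypeO a b c r x y z = ∃[ α ] ∃[ β ] ∃[ γ ] (r ^ α ∥ a) × (r ^ β ∥ b) × (r ^ γ ∥ c)
  × (α * x ≡ β * y) × (β * y ≡ γ * z)

{-# OPTIONS --safe #-}
module Submission where

-- For a prime r, the valuations of the three terms of a^x + b^y = c^z attain their minimum at
-- least twice.  Hence a solution that is not of type A for q has its a-term of least q-valuation,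
-- and a solution of type B, C or O for p has its a-term of least p-valuation.  If (x, y, z) is of
-- type A for p but not for q, comparing ratios of exponents shows that for any solution
-- (x′, y′, z′) of type B, C or O for p the a-term would have strictly least q-valuation, which is
-- impossible.

open import Defs
open import Algebra.Properties.CommutativeSemigroup using (interchange)
open import Data.Nat
  using (ℕ; zero; suc; _+_; _*_; _∸_; _^_; _≤_; _<_; _>_; NonZero; >-nonZero; nonTrivial⇒n>1)
open import Data.Nat.Divisibility
  using (_∣_; divides; _∣?_; ∣-trans; n∣m*n; m*n∣⇒m∣; *-cancelʳ-∣; ∣m+n∣m⇒∣n; ∣m∣n⇒∣m+n; ∣1⇒≡1; 1∣_)
open import Data.Nat.GCD using (gcd)
open import Data.Nat.Induction using (<-wellFounded)
open import Data.Nat.Primality using (Prime; euclidsLemma; prime⇒nonZero; prime⇒nonTrivial; ¬prime[1])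
open import Data.Nat.Properties
open import Data.Product using (_×_; _,_; proj₁; proj₂; ∃-syntax)
open import Data.Sum using (_⊎_; inj₁; inj₂; [_,_]′)
open import Data.Empty using (⊥-elim)
open import Function using (id; _∘_)
open import Induction.WellFounded using (Acc; acc)
open import Relation.Nullary using (¬_; yes; no)
open import Relation.Binary.PropositionalEquality using (_≡_; refl; sym; trans; cong; subst)

m≤n⇒o^m∣o^n : ∀ o {m n} → m ≤ n → o ^ m ∣ o ^ n
m≤n⇒o^m∣o^n o {m} {n} m≤n =
  divides (o ^ (n ∸ m)) (trans (cong (o ^_) (sym (m∸n+n≡m m≤n))) (^-distribˡ-+-* o (n ∸ m) m))

∥∧≤⇒∣ : ∀ {r k v n} → k ≤ v → r ^ v ∥ n → r ^ k ∣ n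
∥∧≤⇒∣ {r} k≤v (rᵛ∣n , _) = ∣-trans (m≤n⇒o^m∣o^n r k≤v) rᵛ∣n

∥-unique : ∀ {r k j n} → r ^ k ∥ n → r ^ j ∥ n → k ≡ j
∥-unique rᵏ∥n rʲ∥n = ≤-antisym (≮⇒≥ (λ j<k → proj₂ rʲ∥n (∥∧≤⇒∣ j<k rᵏ∥n)))
                               (≮⇒≥ (λ k<j → proj₂ rᵏ∥n (∥∧≤⇒∣ k<j rʲ∥n)))

∣∧∥⇒exponent≢0 : ∀ {r k n} → r ∣ n → r ^ k ∥ n → NonZero k
∣∧∥⇒exponent≢0 {r} {zero} r∣n (_ , r¹∤n) = ⊥-elim (r¹∤n (subst (_∣ _) (sym (*-identityʳ r)) r∣n))
∣∧∥⇒exponent≢0 {r} {suc k} _ _ = _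

∤⇒∥⁰ : ∀ {r n} → ¬ r ∣ n → r ^ 0 ∥ n
∤⇒∥⁰ {r} {n} r∤n = 1∣ n , r∤n ∘ m*n∣⇒m∣ r 1

∥⇒cofactor : ∀ {r k n} → r ^ k ∥ n → ∃[ m ] n ≡ m * r ^ k × ¬ r ∣ m
∥⇒cofactor {r} {k} (divides m n≡m*rᵏ , r^1+k∤n) =
  m , n≡m*rᵏ , λ { (divides t refl) → r^1+k∤n (divides t (trans n≡m*rᵏ (*-assoc t r (r ^ k)))) }

cofactor⇒∥ : ∀ {r k m} .{{_ : NonZero r}} → ¬ r ∣ m → r ^ k ∥ (m * r ^ k)
cofactor⇒∥ {r} {k} {m} r∤m = n∣m*n m , λ r^1+k∣n → r∤m (*-cancelʳ-∣ (r ^ k) {{m^n≢0 r k}} r^1+k∣n)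

∥-* : ∀ {r i j m n} → Prime r → r ^ i ∥ m → r ^ j ∥ n → r ^ (i + j) ∥ (m * n)
∥-* {r} {i} {j} r-prime rⁱ∥m rʲ∥n with ∥⇒cofactor {r} {i} rⁱ∥m | ∥⇒cofactor {r} {j} rʲ∥n
... | m′ , refl , r∤m′ | n′ , refl , r∤n′ =
  subst (r ^ (i + j) ∥_) regroup (cofactor⇒∥ {k = i + j} {{prime⇒nonZero r-prime}} r∤m′n′)
  where
  r∤m′n′ : ¬ r ∣ m′ * n′
  r∤m′n′ = [ r∤m′ , r∤n′ ]′ ∘ euclidsLemma m′ n′ r-prime
  regroup : m′ * n′ * r ^ (i + j) ≡ m′ * r ^ i * (n′ * r ^ j)
  regroup = trans (cong (m′ * n′ *_) (^-distribˡ-+-* r i j))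
                  (interchange *-commutativeSemigroup m′ n′ (r ^ i) (r ^ j))

∥-*-self : ∀ {r k m} → Prime r → r ^ k ∥ m → r ^ suc k ∥ (m * r)
∥-*-self {r} {k} r-prime rᵏ∥m with ∥⇒cofactor {r} {k} rᵏ∥m
... | m′ , refl , r∤m′ =
  subst (r ^ suc k ∥_) regroup (cofactor⇒∥ {k = suc k} {{prime⇒nonZero r-prime}} r∤m′)
  where
  regroup : m′ * r ^ suc k ≡ m′ * r ^ k * r
  regroup = trans (cong (m′ *_) (*-comm r (r ^ k))) (sym (*-assoc m′ (r ^ k) r))

∥-^ : ∀ {r k n} → Prime r → r ^ k ∥ n → ∀ x → r ^ (k * x) ∥ (n ^ x)
∥-^ {r} {k} r-prime _ zero rewrite *-zeroʳ k =
  ∤⇒∥⁰ (λ r∣1 → ¬prime[1] (subst Prime (∣1⇒≡1 r∣1) r-prime))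
∥-^ {r} {k} r-prime rᵏ∥n (suc x) rewrite *-suc k x =
  ∥-* {i = k} {k * x} r-prime rᵏ∥n (∥-^ {k = k} r-prime rᵏ∥n x)

exact-power-exists : ∀ {r n} → Prime r → n > 0 → ∃[ k ] r ^ k ∥ n
exact-power-exists {r} {n} r-prime n>0 = go n {{>-nonZero n>0}} (<-wellFounded n)
  where
  go : ∀ n → .{{NonZero n}} → Acc _<_ n → ∃[ k ] r ^ k ∥ n
  go n (acc smaller) with r ∣? n
  ... | no r∤n = 0 , ∤⇒∥⁰ r∤n
  ... | yes (divides m refl) = suc k , ∥-*-self {k = k} r-prime rᵏ∥m
    where
    instance m≢0 = m*n≢0⇒m≢0 m
    exponent-of-m = go m (smaller (m<m*n m r (nonTrivial⇒n>1 r {{prime⇒nonTrivial r-prime}})))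
    k = proj₁ exponent-of-m
    rᵏ∥m = proj₂ exponent-of-m

module _ {r u v w A B C : ℕ} (rᵘ∥A : r ^ u ∥ A) (rᵛ∥B : r ^ v ∥ B) (rʷ∥C : r ^ w ∥ C)
         (A+B≡C : A + B ≡ C) where

  ¬first-strictly-least : ¬ (u < v × u < w)
  ¬first-strictly-least (u<v , u<w) = proj₂ rᵘ∥A (∣m+n∣m⇒∣n r^1+u∣B+A (∥∧≤⇒∣ u<v rᵛ∥B))
    where
    r^1+u∣B+A : r ^ suc u ∣ B + A
    r^1+u∣B+A = subst (_ ∣_) (trans (sym A+B≡C) (+-comm A B)) (∥∧≤⇒∣ u<w rʷ∥C)

  ¬second-strictly-least : ¬ (v < u × v < w)
  ¬second-strictly-least (v<u , v<w) =
    proj₂ rᵛ∥B (∣m+n∣m⇒∣n (subst (_ ∣_) (sym A+B≡C) (∥∧≤⇒∣ v<w rʷ∥C)) (∥∧≤⇒∣ v<u rᵘ∥A))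

  ¬sum-strictly-least : ¬ (w < u × w < v)
  ¬sum-strictly-least (w<u , w<v) =
    proj₂ rʷ∥C (subst (_ ∣_) A+B≡C (∣m∣n⇒∣m+n (∥∧≤⇒∣ w<u rᵘ∥A) (∥∧≤⇒∣ w<v rᵛ∥B)))

  second-less⇒others-equal : v < u → v ≡ w
  second-less⇒others-equal v<u =
    ≤-antisym (≮⇒≥ (λ w<v → ¬sum-strictly-least (<-trans w<v v<u , w<v)))
              (≮⇒≥ (λ v<w → ¬second-strictly-least (v<u , v<w)))

  sum-less⇒second-less : w < u → v < u
  sum-less⇒second-less w<u = ≤-<-trans (≮⇒≥ (λ w<v → ¬sum-strictly-least (w<u , w<v))) w<u

  first-least-or-others-equal : (u ≤ v × u ≤ w) ⊎ (v < u × v ≡ w)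
  first-least-or-others-equal with u ≤? v | u ≤? w
  ... | yes u≤v | yes u≤w = inj₁ (u≤v , u≤w)
  ... | no u≰v  | _       = inj₂ (≰⇒> u≰v , second-less⇒others-equal (≰⇒> u≰v))
  ... | yes _   | no u≰w  = inj₂ (v<u , second-less⇒others-equal v<u)
    where v<u = sum-less⇒second-less (≰⇒> u≰w)

ab∙cd≡ad∙cb : ∀ a b c d → a * b * (c * d) ≡ a * d * (c * b)
ab∙cd≡ad∙cb a b c d = trans (cong (a * b *_) (*-comm c d))
  (trans (interchange *-commutativeSemigroup a b d c) (cong (a * d *_) (*-comm b c)))

-- In ratio form: α′/β′ ≤ y/x < α/β ≤ y′/x′.
cross-ratio-< : ∀ {α β α′ β′ x y x′ y′} .{{_ : NonZero β′}} .{{_ : NonZero y′}} →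
  α′ * x ≤ β′ * y → β * y < α * x → α * x′ ≤ β * y′ → α′ * x′ < β′ * y′
cross-ratio-< {α} {β} {α′} {β′} {x} {y} {x′} {y′} α′x≤β′y βy<αx αx′≤βy′ =
  ≰⇒> λ β′y′≤α′x′ → <-irrefl refl (begin-strict
    β′ * y′ * (α * x)  ≤⟨ *-monoˡ-≤ (α * x) β′y′≤α′x′ ⟩
    α′ * x′ * (α * x)  ≡⟨ ab∙cd≡ad∙cb α′ x′ α x ⟩
    α′ * x * (α * x′)  ≤⟨ *-monoʳ-≤ (α′ * x) αx′≤βy′ ⟩
    α′ * x * (β * y′)  ≤⟨ *-monoˡ-≤ (β * y′) α′x≤β′y ⟩
    β′ * y * (β * y′)  ≡⟨ ab∙cd≡ad∙cb β′ y β y′ ⟩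
    β′ * y′ * (β * y)  <⟨ *-monoʳ-< (β′ * y′) βy<αx ⟩
    β′ * y′ * (α * x)  ∎)
  where
  open ≤-Reasoning
  instance β′y′≢0 = m*n≢0 β′ y′

module ExactExponents {r a b c : ℕ} (α β γ : ℕ)
         (rᵅ∥a : r ^ α ∥ a) (rᵝ∥b : r ^ β ∥ b) (rᵞ∥c : r ^ γ ∥ c) where

  at-exact-exponents : {R : ℕ → ℕ → ℕ → Set} →
    ∃[ α′ ] ∃[ β′ ] ∃[ γ′ ] (r ^ α′ ∥ a) × (r ^ β′ ∥ b) × (r ^ γ′ ∥ c) × R α′ β′ γ′ → R α β γ
  at-exact-exponents (α′ , β′ , γ′ , rᵅ′∥a , rᵝ′∥b , rᵞ′∥c , R-holds)
    with ∥-unique {k = α} {α′} rᵅ∥a rᵅ′∥a | ∥-unique {k = β} {β′} rᵝ∥b rᵝ′∥b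
       | ∥-unique {k = γ} {γ′} rᵞ∥c rᵞ′∥c
  ... | refl | refl | refl = R-holds

  typeBCO⇒first-term-least : ∀ {x y z} →
    TypeB a b c r x y z ⊎ TypeC a b c r x y z ⊎ TypeO a b c r x y z →
    α * x ≤ β * y × α * x ≤ γ * z
  typeBCO⇒first-term-least (inj₁ typeB) with at-exact-exponents typeB
  ... | αx<βy , αx≡γz = <⇒≤ αx<βy , ≤-reflexive αx≡γz
  typeBCO⇒first-term-least (inj₂ (inj₁ typeC)) with at-exact-exponents typeC
  ... | αx<γz , αx≡βy = ≤-reflexive αx≡βy , <⇒≤ αx<γz
  typeBCO⇒first-term-least (inj₂ (inj₂ typeO)) with at-exact-exponents typeO
  ... | αx≡βy , βy≡γz = ≤-reflexive αx≡βy , ≤-reflexive (trans αx≡βy βy≡γz)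

  module _ (r-prime : Prime r) {x y z : ℕ} (sum : a ^ x + b ^ y ≡ c ^ z) where

    ¬first-term-strictly-least : ¬ (α * x < β * y × α * x < γ * z)
    ¬first-term-strictly-least = ¬first-strictly-least {r} {α * x} {β * y} {γ * z}
      (∥-^ {k = α} r-prime rᵅ∥a x) (∥-^ {k = β} r-prime rᵝ∥b y) (∥-^ {k = γ} r-prime rᵞ∥c z) sum

    first-term-least-or-typeA : (α * x ≤ β * y × α * x ≤ γ * z) ⊎ (β * y < α * x × β * y ≡ γ * z)
    first-term-least-or-typeA = first-least-or-others-equal {r} {α * x} {β * y} {γ * z}
      (∥-^ {k = α} r-prime rᵅ∥a x) (∥-^ {k = β} r-prime rᵝ∥b y) (∥-^ {k = γ} r-prime rᵞ∥c z) sum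

mainTheorem14 : (a b c : ℕ) → a > 1 → b > 1 → c > 1 → gcd a b > 1 →
    (p q x y z : ℕ) → InQ a b c p → InQ a b c q →
    IsSolution a b c x y z → TypeA a b c p x y z → ¬ TypeA a b c q x y z →
    (x′ y′ z′ : ℕ) → IsSolution a b c x′ y′ z′ →
    ¬ (TypeB a b c p x′ y′ z′ ⊎ TypeC a b c p x′ y′ z′ ⊎ TypeO a b c p x′ y′ z′)
mainTheorem14 a b c a>1 b>1 c>1 _ p q x y z _ (q-prime , _ , q∣b , q∣c) (_ , _ , _ , sum)
  (α , β , γ , pᵅ∥a , pᵝ∥b , pᵞ∥c , βy<αx , βy≡γz) ¬typeA-q x′ y′ z′ (_ , y′>0 , z′>0 , sum′) typeBCO
  with exact-power-exists q-prime (<⇒≤ a>1) | exact-power-exists q-prime (<⇒≤ b>1)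
     | exact-power-exists q-prime (<⇒≤ c>1)
... | α′ , qᵅ′∥a | β′ , qᵝ′∥b | γ′ , qᵞ′∥c =
  Q.¬first-term-strictly-least q-prime sum′
    ( cross-ratio-< {α} {β} {α′} {β′} {x} {y} {x′} {y′} (proj₁ q-least) βy<αx (proj₁ p-least)
    , cross-ratio-< {α} {γ} {α′} {γ′} {x} {z} {x′} {z′} (proj₂ q-least) γz<αx (proj₂ p-least))
  where
  module P = ExactExponents α β γ pᵅ∥a pᵝ∥b pᵞ∥c
  module Q = ExactExponents α′ β′ γ′ qᵅ′∥a qᵝ′∥b qᵞ′∥c
  instance
    β′≢0 = ∣∧∥⇒exponent≢0 {k = β′} q∣b qᵝ′∥b
    γ′≢0 = ∣∧∥⇒exponent≢0 {k = γ′} q∣c qᵞ′∥c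
    y′≢0 = >-nonZero y′>0
    z′≢0 = >-nonZero z′>0
  γz<αx : γ * z < α * x
  γz<αx = subst (_< α * x) βy≡γz βy<αx
  q-least : α′ * x ≤ β′ * y × α′ * x ≤ γ′ * z
  q-least = [ id , (λ typeA → ⊥-elim (¬typeA-q (α′ , β′ , γ′ , qᵅ′∥a , qᵝ′∥b , qᵞ′∥c , typeA))) ]′
    (Q.first-term-least-or-typeA q-prime sum)
  p-least : α * x′ ≤ β * y′ × α * x′ ≤ γ * z′
  p-least = P.typeBCO⇒first-term-least typeBCO
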